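{- Let $\delta\colon\subseteq\mathbb{N}^{\mathbb{N}}\to X$ be a representation. Assume that there exists an algorithm which takes as input a name $p\in\operatorname{dom}\delta$ of a point $x\in X$ and a finite sequence $q_0\in\mathbb{N}^*$ of integers, and which halts if and only if $q_0$ can be extended to a name $q\in\operatorname{dom}\delta$ of $x$. Then $\delta$ is an open map.
   Context: $\mathbb{N}^{\mathbb{N}}$ carries the product (Baire) topology and $\operatorname{dom}\delta$ the subspace topology. A representation of $X$ is a partial surjection $\delta\colon\subseteq\mathbb{N}^{\mathbb{N}}\to X$; $p$ is a name of $x$ if $\delta(p)=x$; $X$ carries the final topology of $\delta$. Algorithms operating on infinite sequences are oracle Turing machines reading the input sequence $p$ via queries. $\delta$ is open if it maps open subsets of $\operatorname{dom}\delta$ to open subsets of $X$. -}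

module Defs where

open import Data.Nat using (ℕ; zero; suc; _<_)
open import Data.Bool using (Bool; true)
open import Data.List using (List; []; _∷_)
open import Data.Product using (Σ; ∃; _×_; _,_)
open import Data.Unit using (⊤)
open import Relation.Binary.PropositionalEquality using (_≡_)

Baire : Set
Baire = ℕ → ℕ

Agree : ℕ → Baire → Baire → Set
Agree n p q = ∀ i → i < n → p i ≡ q i

OpenBaire : (Baire → Set) → Set
OpenBaire W = ∀ p → W p → ∃ λ n → ∀ q → Agree n p q → W q

Dom : (Baire → Set) → Set
Dom D = Σ Baire D

OpenSub : (D : Baire → Set) → (Dom D → Set) → Set₁
OpenSub D V = Σ (Baire → Set) λ W →
  OpenBaire W × (∀ p (d : D p) → (V (p , d) → W p) × (W p → V (p , d)))

Surjective : {D : Baire → Set} {X : Set} → (Dom D → X) → Set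
Surjective {D} {X} δ = ∀ (x : X) → ∃ λ (v : Dom D) → δ v ≡ x

-- final topology of δ on X
OpenFinal : {D : Baire → Set} {X : Set} → (Dom D → X) → (X → Set) → Set₁
OpenFinal {D} δ U = OpenSub D (λ v → U (δ v))

Image : {D : Baire → Set} {X : Set} → (Dom D → X) → (Dom D → Set) → X → Set
Image {D} δ V x = ∃ λ (v : Dom D) → V v × δ v ≡ x

IsOpenMap : {D : Baire → Set} {X : Set} → (Dom D → X) → Set₁
IsOpenMap {D} δ = ∀ (V : Dom D → Set) → OpenSub D V → OpenFinal δ (Image δ V)

Prefix : List ℕ → Baire → Set
Prefix []       q = ⊤
Prefix (a ∷ w)  q = (a ≡ q 0) × Prefix w (λ i → q (suc i))

-- Oracle computations: a finite-time computation with oracle access is a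
-- well-founded dialogue tree querying oracle positions and finally
-- reporting whether the machine has halted.
data Dialogue : Set where
  answer : Bool → Dialogue
  ask    : ℕ → (ℕ → Dialogue) → Dialogue

eval : Dialogue → Baire → Bool
eval (answer b) p = b
eval (ask n k)  p = eval (k (p n)) p

-- An oracle machine with an extra finite input: for each input word and
-- step bound t, the dialogue describing its run for t steps
-- (answer true = has halted within t steps).
OracleMachine : Set
OracleMachine = List ℕ → ℕ → Dialogue

Halts : OracleMachine → Baire → List ℕ → Set
Halts M p w = ∃ λ t → eval (M w t) p ≡ true

-- A halting run of the machine reads only finitely many digits of p, so the set of
-- names p on which it halts with input w is open in Baire space; by hypothesis it is
-- the full preimage of the image of the cylinder [w]. Hence images of cylinders are
-- open, and an open V ⊆ dom δ, being a union of cylinders, has an open image.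
module Submission where

open import Defs
open import Data.Nat using (ℕ; zero; suc; _≤_; _⊔_; s≤s)
open import Data.Nat.Properties using (m≤m⊔n; m≤n⊔m; <-≤-trans)
open import Data.List using (List; []; _∷_)
open import Data.Product using (Σ; ∃; _×_; _,_; proj₁; proj₂)
open import Data.Unit using (tt)
open import Relation.Binary.PropositionalEquality using (_≡_; refl; sym; trans; cong; module ≡-Reasoning)

Agree-≤ : ∀ {m n p q} → m ≤ n → Agree n p q → Agree m p q
Agree-≤ m≤n agree i i<m = agree i (<-≤-trans i<m m≤n)

eval-continuous : ∀ d p → ∃ λ n → ∀ q → Agree n p q → eval d q ≡ eval d p
eval-continuous (answer b) p = 0 , λ _ _ → refl
eval-continuous (ask i k) p with eval-continuous (k (p i)) p
... | n , k-continuous = suc i ⊔ n , λ q agree →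
  begin
    eval (k (q i)) q  ≡⟨ cong (λ a → eval (k a) q) (sym (agree i (m≤m⊔n (suc i) n))) ⟩
    eval (k (p i)) q  ≡⟨ k-continuous q (Agree-≤ (m≤n⊔m (suc i) n) agree) ⟩
    eval (k (p i)) p  ∎
  where open ≡-Reasoning

Halts-open : ∀ M w → OpenBaire (λ p → Halts M p w)
Halts-open M w p (t , halted) with eval-continuous (M w t) p
... | n , continuous = n , λ q agree → t , trans (continuous q agree) halted

take : ℕ → Baire → List ℕ
take zero    q = []
take (suc n) q = q 0 ∷ take n (λ i → q (suc i))

Prefix-take : ∀ n q → Prefix (take n q) q
Prefix-take zero    q = tt
Prefix-take (suc n) q = refl , Prefix-take n (λ i → q (suc i))

Prefix-take⇒Agree : ∀ n q q′ → Prefix (take n q) q′ → Agree n q q′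
Prefix-take⇒Agree (suc n) q q′ (q0≡q′0 , _) zero _ = q0≡q′0
Prefix-take⇒Agree (suc n) q q′ (_ , prefix) (suc i) (s≤s i<n) =
  Prefix-take⇒Agree n (λ j → q (suc j)) (λ j → q′ (suc j)) prefix i i<n

module _ {D : Baire → Set} {X : Set} (δ : Dom D → X) where

  CylinderImage : List ℕ → X → Set
  CylinderImage w = Image δ (λ v → Prefix w (proj₁ v))

  openCylinderImages⇒IsOpenMap : (∀ w → OpenFinal δ (CylinderImage w)) → IsOpenMap δ
  openCylinderImages⇒IsOpenMap cylinderImage-open V (W , W-open , W≡V) =
    W′ , W′-open , λ p pd → image⇒W′ p pd , W′⇒image p pd
    where
    U : List ℕ → Baire → Set
    U w = proj₁ (cylinderImage-open w)

    U-open : ∀ w → OpenBaire (U w)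
    U-open w = proj₁ (proj₂ (cylinderImage-open w))

    image⇒U : ∀ w p pd → CylinderImage w (δ (p , pd)) → U w p
    image⇒U w p pd = proj₁ (proj₂ (proj₂ (cylinderImage-open w)) p pd)

    U⇒image : ∀ w p pd → U w p → CylinderImage w (δ (p , pd))
    U⇒image w p pd = proj₂ (proj₂ (proj₂ (cylinderImage-open w)) p pd)

    W′ : Baire → Set
    W′ p = ∃ λ w → (∀ q → Prefix w q → W q) × U w p

    W′-open : OpenBaire W′
    W′-open p (w , [w]⊆W , Uwp) with U-open w p Uwp
    ... | n , cylinder⊆Uw = n , λ q agree → w , [w]⊆W , cylinder⊆Uw q agree

    image⇒W′ : ∀ p pd → Image δ V (δ (p , pd)) → W′ p
    image⇒W′ p pd ((q , qd) , Vq , δq≡δp) with W-open q (proj₁ (W≡V q qd) Vq)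
    ... | n , cylinder⊆W =
      take n q
      , (λ q′ prefix → cylinder⊆W q′ (Prefix-take⇒Agree n q q′ prefix))
      , image⇒U (take n q) p pd ((q , qd) , Prefix-take n q , δq≡δp)

    W′⇒image : ∀ p pd → W′ p → Image δ V (δ (p , pd))
    W′⇒image p pd (w , [w]⊆W , Uwp) with U⇒image w p pd Uwp
    ... | (q , qd) , prefix , δq≡δp = (q , qd) , proj₂ (W≡V q qd) ([w]⊆W q prefix) , δq≡δp

propositionA3 : (X : Set) (D : Baire → Set) (δ : Dom D → X) →
    Surjective δ →
    (M : OracleMachine) →
    (∀ (p : Baire) (pd : D p) (w : List ℕ) →
      (Halts M p w → ∃ λ (q : Baire) → Σ (D q) λ qd → Prefix w q × δ (q , qd) ≡ δ (p , pd))
      × ((∃ λ (q : Baire) → Σ (D q) λ qd → Prefix w q × δ (q , qd) ≡ δ (p , pd)) → Halts M p w)) →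
    IsOpenMap δ
propositionA3 X D δ _ M halts⇔extendable = openCylinderImages⇒IsOpenMap δ λ w →
  (λ p → Halts M p w) , Halts-open M w , λ p pd →
    (λ { ((q , qd) , prefix , δq≡δp) → proj₂ (halts⇔extendable p pd w) (q , qd , prefix , δq≡δp) })
    , (λ halts → let (q , qd , prefix , δq≡δp) = proj₁ (halts⇔extendable p pd w) halts
                 in (q , qd) , prefix , δq≡δp)
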